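{- For every positive integer $n$, the polynomial $N_n(t)=N_{nn}(t)$ is palindromic.
   Context: For nonnegative integers $p,q$ let $W_{pq}(t)=\sum_{k=0}^{\min\{p,q\}-1}\binom{p-1}{k}\binom{q-1}{k}t^k$. Define polynomials $N_{pq}(t)$ for nonnegative integers $p,q$ by $N_{0,q}=N_{p,0}=N_{1,1}=0$ and, for $p,q\ge1$ with $(p,q)\neq(1,1)$, $$N_{pq}=N_{p-1,q}+N_{p,q-1}-(1-t)N_{p-1,q-1}+|p-q|\,t\,W_{pq}.$$ A polynomial $f(t)=\sum_{k=a}^b f_kt^k$ with $f_a\neq0$, $f_b\neq0$ is called palindromic if $f_k=f_{a+b-k}$ for all $a\le k\le b$ (equivalently $f(t)=t^{a+b}f(1/t)$). -}

module Defs where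

open import Data.Nat as ℕ using (ℕ; zero; suc; _<_; _≤_; _∸_; ∣_-_∣)
open import Data.Nat.Combinatorics using (_C_)
open import Data.Integer as ℤ using (ℤ; +_; _+_; _-_; _*_)
open import Data.Product using (_×_)
open import Relation.Binary.PropositionalEquality using (_≡_; _≢_)

-- A polynomial with integer coefficients is represented by its coefficient
-- function: Poly f means f k is the coefficient of t^k.
Poly : Set
Poly = ℕ → ℤ

tMul : Poly → Poly
tMul f zero    = + 0
tMul f (suc k) = f k

-- W p q (t) = sum_{k=0}^{min p q - 1} C(p-1,k) C(q-1,k) t^k.
-- For p = 0 or q = 0 the sum is empty.  For p, q ≥ 1, the binomials vanish
-- automatically for k > min p q - 1.
W : ℕ → ℕ → Poly
W zero    q       k = + 0
W (suc p) zero    k = + 0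
W (suc p) (suc q) k = + ((p C k) ℕ.* (q C k))

N : ℕ → ℕ → Poly
N zero          q             k = + 0
N (suc p)       zero          k = + 0
N (suc zero)    (suc zero)    k = + 0
N (suc p)       (suc q)       k =
  ((N p (suc q) k + N (suc p) q k) - (N p q k - tMul (N p q) k))
  + (+ ∣ p - q ∣) * tMul (W (suc p) (suc q)) k

IsLowest : Poly → ℕ → Set
IsLowest f a = (f a ≢ + 0) × (∀ k → k < a → f k ≡ + 0)

IsHighest : Poly → ℕ → Set
IsHighest f b = (f b ≢ + 0) × (∀ k → b < k → f k ≡ + 0)

Palindromic : Poly → Set
Palindromic f = ∀ a b → IsLowest f a → IsHighest f b →
  ∀ k → a ≤ k → k ≤ b → f k ≡ f ((a ℕ.+ b) ∸ k)

{-# OPTIONS --safe #-}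
-- The coefficient of t^k in N_{pq} has a combinatorial model: it is the sum, over pairs of
-- binary words w, v of lengths p, q with k ones each, of the area between w and v, i.e. the
-- total gap between the numbers of ones in their suffixes once both are left-padded with zeros
-- to a common length. The model satisfies the defining recurrence: a leading zero is absorbed
-- by the padding, so inclusion–exclusion leaves the pairs of length (p + 1, q + 1) starting
-- with two ones, and each of these has the area of its tails plus |p − q|; summing 1 over the
-- C(p, k − 1) C(q, k − 1) such pairs produces the term |p − q| t W. On the diagonal p = q = n,
-- complementing both words exchanges k ones with n − k ones and preserves the area, so the
-- coefficients satisfy c_k = c_{n−k} and vanish beyond n, which forces palindromicity.
module Submission where

open import Defs
open import Data.Nat using (ℕ; _≤_)

open import Data.Bool using (Bool; true; false; not)
open import Data.List using (List; []; _∷_; _++_; length; map; replicate)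
open import Data.Nat using (zero; suc; _+_; _*_; _∸_; ∣_-_∣; _<_; z≤n; s≤s)
open import Data.Nat.Combinatorics using (_C_; nCk+nC[k+1]≡[n+1]C[k+1])
open import Data.Nat.Properties
open import Data.Nat.Tactic.RingSolver using (solve-∀)
open import Data.Integer as ℤ using (ℤ)
import Data.Integer.Properties as ℤ
import Data.Integer.Tactic.RingSolver as ℤ-Solver
open import Data.Product using (_,_)
open import Data.Empty using (⊥-elim)
open import Relation.Nullary using (yes; no)
open import Function using (_∘_)
open import Relation.Binary.PropositionalEquality

∣-∣-shift : ∀ a b x y → a + x ≡ b + y → ∣ a - b ∣ ≡ ∣ x - y ∣
∣-∣-shift a b x y eq = begin
  ∣ a - b ∣             ≡⟨ ∣-∣-comm a b ⟩
  ∣ b - a ∣             ≡⟨ sym (∣m+n-m+o∣≡∣n-o∣ y b a) ⟩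
  ∣ y + b - y + a ∣     ≡⟨ cong₂ ∣_-_∣ (+-comm y b) (+-comm y a) ⟩
  ∣ b + y - a + y ∣     ≡⟨ cong (∣_- a + y ∣) (sym eq) ⟩
  ∣ a + x - a + y ∣     ≡⟨ ∣m+n-m+o∣≡∣n-o∣ a x y ⟩
  ∣ x - y ∣             ∎
  where open ≡-Reasoning

∣m-1+n∣≡1+∣m-n∣ : ∀ {m n} → m ≤ n → ∣ m - suc n ∣ ≡ suc ∣ m - n ∣
∣m-1+n∣≡1+∣m-n∣ {m} {n} m≤n = begin
  ∣ m - suc n ∣ ≡⟨ m≤n⇒∣m-n∣≡n∸m (m≤n⇒m≤1+n m≤n) ⟩
  suc n ∸ m     ≡⟨ +-∸-assoc 1 m≤n ⟩
  suc (n ∸ m)   ≡⟨ cong suc (sym (m≤n⇒∣m-n∣≡n∸m m≤n)) ⟩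
  suc ∣ m - n ∣ ∎
  where open ≡-Reasoning

replicate-++-∷ : ∀ {A : Set} a (z : A) xs → replicate a z ++ z ∷ xs ≡ replicate (suc a) z ++ xs
replicate-++-∷ zero    z xs = refl
replicate-++-∷ (suc a) z xs = cong (z ∷_) (replicate-++-∷ a z xs)

Word : Set
Word = List Bool

weight : Word → ℕ
weight []          = 0
weight (true  ∷ w) = suc (weight w)
weight (false ∷ w) = weight w

complement : Word → Word
complement = map not

weight-∷-≥ : ∀ b x → weight x ≤ weight (b ∷ x)
weight-∷-≥ true  x = n≤1+n (weight x)
weight-∷-≥ false x = ≤-refl

weight-complement : ∀ x → weight (complement x) + weight x ≡ length x
weight-complement []          = refl
weight-complement (true ∷ x)  = trans (+-suc _ (weight x)) (cong suc (weight-complement x))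
weight-complement (false ∷ x) = cong suc (weight-complement x)

weight-falses++ : ∀ a x → weight (replicate a false ++ x) ≡ weight x
weight-falses++ zero    x = refl
weight-falses++ (suc a) x = weight-falses++ a x

sumWords : ℕ → ℕ → (Word → ℕ) → ℕ
sumWords zero    zero    h = h []
sumWords zero    (suc k) h = 0
sumWords (suc n) zero    h = sumWords n zero (h ∘ (false ∷_))
sumWords (suc n) (suc k) h = sumWords n (suc k) (h ∘ (false ∷_)) + sumWords n k (h ∘ (true ∷_))

sumWords-cong : ∀ n k {f g : Word → ℕ} →
  (∀ w → length w ≡ n → weight w ≡ k → f w ≡ g w) → sumWords n k f ≡ sumWords n k g
sumWords-cong zero    zero    f≗g = f≗g [] refl refl
sumWords-cong zero    (suc k) f≗g = refl
sumWords-cong (suc n) zero    f≗g =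
  sumWords-cong n zero (λ w ∣w∣ wt → f≗g (false ∷ w) (cong suc ∣w∣) wt)
sumWords-cong (suc n) (suc k) f≗g = cong₂ _+_
  (sumWords-cong n (suc k) (λ w ∣w∣ wt → f≗g (false ∷ w) (cong suc ∣w∣) wt))
  (sumWords-cong n k (λ w ∣w∣ wt → f≗g (true ∷ w) (cong suc ∣w∣) (cong suc wt)))

sumWords-const : ∀ n k c → sumWords n k (λ _ → c) ≡ c * (n C k)
sumWords-const zero    zero    c = sym (*-identityʳ c)
sumWords-const zero    (suc k) c = sym (*-zeroʳ c)
sumWords-const (suc n) zero    c = sumWords-const n zero c
sumWords-const (suc n) (suc k) c = begin
  sumWords n (suc k) (λ _ → c) + sumWords n k (λ _ → c)
    ≡⟨ cong₂ _+_ (sumWords-const n (suc k) c) (sumWords-const n k c) ⟩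
  c * (n C suc k) + c * (n C k)  ≡⟨ +-comm (c * (n C suc k)) (c * (n C k)) ⟩
  c * (n C k) + c * (n C suc k)  ≡⟨ sym (*-distribˡ-+ c (n C k) (n C suc k)) ⟩
  c * (n C k + n C suc k)        ≡⟨ cong (c *_) (nCk+nC[k+1]≡[n+1]C[k+1] n k) ⟩
  c * (suc n C suc k)            ∎
  where open ≡-Reasoning

sumWords-zero : ∀ n k {h : Word → ℕ} →
  (∀ w → length w ≡ n → weight w ≡ k → h w ≡ 0) → sumWords n k h ≡ 0
sumWords-zero n k h≗0 = trans (sumWords-cong n k h≗0) (sumWords-const n k 0)

sumWords-+ : ∀ n k (f g : Word → ℕ) →
  sumWords n k (λ w → f w + g w) ≡ sumWords n k f + sumWords n k g
sumWords-+ zero    zero    f g = refl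
sumWords-+ zero    (suc k) f g = refl
sumWords-+ (suc n) zero    f g = sumWords-+ n zero (f ∘ (false ∷_)) (g ∘ (false ∷_))
sumWords-+ (suc n) (suc k) f g = begin
  sumWords n (suc k) (λ w → f (false ∷ w) + g (false ∷ w))
    + sumWords n k (λ w → f (true ∷ w) + g (true ∷ w))
    ≡⟨ cong₂ _+_ (sumWords-+ n (suc k) _ _) (sumWords-+ n k _ _) ⟩
  (a + b) + (c + d)
    ≡⟨ interchange a b c d ⟩
  (a + c) + (b + d) ∎
  where
  open ≡-Reasoning
  a b c d : ℕ
  a = sumWords n (suc k) (f ∘ (false ∷_))
  b = sumWords n (suc k) (g ∘ (false ∷_))
  c = sumWords n k (f ∘ (true ∷_))
  d = sumWords n k (g ∘ (true ∷_))
  interchange : ∀ a b c d → (a + b) + (c + d) ≡ (a + c) + (b + d)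
  interchange = solve-∀

sumWords-overweight : ∀ {n k} (h : Word → ℕ) → n < k → sumWords n k h ≡ 0
sumWords-overweight {zero}  {suc k} h _ = refl
sumWords-overweight {suc n} {suc k} h (s≤s n<k) =
  cong₂ _+_ (sumWords-overweight _ (m<n⇒m<1+n n<k)) (sumWords-overweight _ n<k)

sumWords-complement : ∀ n a b (h : Word → ℕ) → a + b ≡ n →
  sumWords n b h ≡ sumWords n a (h ∘ complement)
sumWords-complement zero    zero    zero    h _ = refl
sumWords-complement (suc n) zero    (suc b) h refl =
  trans (cong (_+ sumWords b b (h ∘ (true ∷_))) (sumWords-overweight (h ∘ (false ∷_)) (n<1+n b)))
        (sumWords-complement n zero b (h ∘ (true ∷_)) refl)
sumWords-complement (suc n) (suc a) zero    h refl =
  trans (sumWords-complement n a zero (h ∘ (false ∷_)) refl)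
        (sym (cong (_+ sumWords (a + zero) a (h ∘ complement ∘ (true ∷_)))
                   (sumWords-overweight (h ∘ complement ∘ (false ∷_)) (s≤s (≤-reflexive (+-identityʳ a))))))
sumWords-complement (suc n) (suc a) (suc b) h eq = begin
  sumWords n (suc b) (h ∘ (false ∷_)) + sumWords n b (h ∘ (true ∷_))
    ≡⟨ cong₂ _+_ (sumWords-complement n a (suc b) _ (suc-injective eq))
                 (sumWords-complement n (suc a) b _ (trans (sym (+-suc a b)) (suc-injective eq))) ⟩
  sumWords n a (h ∘ complement ∘ (true ∷_)) + sumWords n (suc a) (h ∘ complement ∘ (false ∷_))
    ≡⟨ +-comm (sumWords n a (h ∘ complement ∘ (true ∷_))) _ ⟩
  sumWords n (suc a) (h ∘ complement ∘ (false ∷_)) + sumWords n a (h ∘ complement ∘ (true ∷_)) ∎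
  where open ≡-Reasoning

doubleSum : ℕ → ℕ → ℕ → (Word → Word → ℕ) → ℕ
doubleSum p q k f = sumWords p k λ w → sumWords q k λ v → f w v

doubleSum-cong : ∀ p q k {f g : Word → Word → ℕ} →
  (∀ w v → length w ≡ p → length v ≡ q → weight w ≡ k → weight v ≡ k → f w v ≡ g w v) →
  doubleSum p q k f ≡ doubleSum p q k g
doubleSum-cong p q k f≗g =
  sumWords-cong p k λ w ∣w∣ wt → sumWords-cong q k λ v ∣v∣ wt′ → f≗g w v ∣w∣ ∣v∣ wt wt′

doubleSum-+-const : ∀ p q k c (f : Word → Word → ℕ) →
  doubleSum p q k (λ w v → f w v + c) ≡ doubleSum p q k f + c * ((p C k) * (q C k))
doubleSum-+-const p q k c f = begin
  doubleSum p q k (λ w v → f w v + c)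
    ≡⟨ sumWords-cong p k (λ w _ _ → sumWords-+ q k (f w) (λ _ → c)) ⟩
  sumWords p k (λ w → sumWords q k (f w) + sumWords q k (λ _ → c))
    ≡⟨ sumWords-+ p k (λ w → sumWords q k (f w)) (λ _ → sumWords q k (λ _ → c)) ⟩
  doubleSum p q k f + sumWords p k (λ _ → sumWords q k (λ _ → c))
    ≡⟨ cong (doubleSum p q k f +_) (trans (cong (λ m → sumWords p k (λ _ → m)) (sumWords-const q k c))
                                          (sumWords-const p k (c * (q C k)))) ⟩
  doubleSum p q k f + c * (q C k) * (p C k)
    ≡⟨ cong (doubleSum p q k f +_) (reassoc c (q C k) (p C k)) ⟩
  doubleSum p q k f + c * ((p C k) * (q C k)) ∎
  where
  open ≡-Reasoning
  reassoc : ∀ c x y → c * x * y ≡ c * (y * x)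
  reassoc = solve-∀

doubleSum-split : ∀ p q j (f : Word → Word → ℕ) →
  (∀ w v → length w ≡ p → f (false ∷ w) v ≡ f w v) →
  (∀ w v → length v ≡ q → f w (false ∷ v) ≡ f w v) →
  doubleSum (suc p) (suc q) (suc j) f + doubleSum p q (suc j) f
    ≡ (doubleSum p (suc q) (suc j) f + doubleSum (suc p) q (suc j) f)
      + doubleSum p q j (λ w v → f (true ∷ w) (true ∷ v))
doubleSum-split p q j f dropˡ dropʳ = begin
  doubleSum (suc p) (suc q) (suc j) f + A₀₀
    ≡⟨ cong (_+ A₀₀) (cong₂ _+_
         (trans (sumWords-+ p (suc j) _ _) (cong₂ _+_ ff≡A₀₀ ft≡A₀₁))
         (trans (sumWords-+ p j _ _) (cong (_+ B) tf≡A₁₀))) ⟩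
  ((A₀₀ + A₀₁) + (A₁₀ + B)) + A₀₀
    ≡⟨ rearrange A₀₀ A₀₁ A₁₀ B ⟩
  ((A₀₀ + A₀₁) + (A₀₀ + A₁₀)) + B
    ≡⟨ cong (_+ B) (cong₂ _+_
         (sym (trans (sumWords-+ p (suc j) _ _)
                     (cong (_+ A₀₁) (doubleSum-cong p q (suc j) λ w v _ ∣v∣ _ _ → dropʳ w v ∣v∣))))
         (sym (cong (_+ A₁₀) (doubleSum-cong p q (suc j) λ w v ∣w∣ _ _ _ → dropˡ w v ∣w∣)))) ⟩
  (doubleSum p (suc q) (suc j) f + doubleSum (suc p) q (suc j) f) + B ∎
  where
  open ≡-Reasoning
  A₀₀ A₀₁ A₁₀ B : ℕ
  A₀₀ = doubleSum p q (suc j) f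
  A₀₁ = sumWords p (suc j) λ w → sumWords q j λ v → f w (true ∷ v)
  A₁₀ = sumWords p j λ w → sumWords q (suc j) λ v → f (true ∷ w) v
  B   = doubleSum p q j (λ w v → f (true ∷ w) (true ∷ v))
  ff≡A₀₀ : doubleSum p q (suc j) (λ w v → f (false ∷ w) (false ∷ v)) ≡ A₀₀
  ff≡A₀₀ = doubleSum-cong p q (suc j) λ w v ∣w∣ ∣v∣ _ _ →
    trans (dropˡ w (false ∷ v) ∣w∣) (dropʳ w v ∣v∣)
  ft≡A₀₁ : (sumWords p (suc j) λ w → sumWords q j λ v → f (false ∷ w) (true ∷ v)) ≡ A₀₁
  ft≡A₀₁ = sumWords-cong p (suc j) λ w ∣w∣ _ → sumWords-cong q j λ v _ _ → dropˡ w (true ∷ v) ∣w∣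
  tf≡A₁₀ : (sumWords p j λ w → sumWords q (suc j) λ v → f (true ∷ w) (false ∷ v)) ≡ A₁₀
  tf≡A₁₀ = sumWords-cong p j λ w _ _ → sumWords-cong q (suc j) λ v ∣v∣ _ → dropʳ (true ∷ w) v ∣v∣
  rearrange : ∀ a b c d → ((a + b) + (c + d)) + a ≡ ((a + b) + (a + c)) + d
  rearrange = solve-∀

doubleSum-complement : ∀ n k (f : Word → Word → ℕ) → k ≤ n →
  doubleSum n n k f ≡ doubleSum n n (n ∸ k) (λ w v → f (complement w) (complement v))
doubleSum-complement n k f k≤n =
  trans (sumWords-complement n (n ∸ k) k (λ w → sumWords n k (f w)) (m∸n+n≡m k≤n))
        (sumWords-cong n (n ∸ k) λ w _ _ → sumWords-complement n (n ∸ k) k (f (complement w)) (m∸n+n≡m k≤n))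

area : Word → Word → ℕ
area (_ ∷ x) (_ ∷ y) = area x y + ∣ weight x - weight y ∣
area _       _       = 0

area-comm : ∀ x y → area x y ≡ area y x
area-comm []      []      = refl
area-comm []      (_ ∷ _) = refl
area-comm (_ ∷ _) []      = refl
area-comm (_ ∷ x) (_ ∷ y) = cong₂ _+_ (area-comm x y) (∣-∣-comm (weight x) (weight y))

area-self : ∀ x → area x x ≡ 0
area-self []      = refl
area-self (_ ∷ x) = cong₂ _+_ (area-self x) (∣n-n∣≡0 (weight x))

area-weightless : ∀ x y → weight x ≡ 0 → weight y ≡ 0 → area x y ≡ 0
area-weightless []          _           _  _  = refl
area-weightless (_ ∷ _)     []          _  _  = refl
area-weightless (true ∷ _)  (_ ∷ _)     () _
area-weightless (false ∷ _) (true ∷ _)  _  ()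
area-weightless (false ∷ x) (false ∷ y) wx wy =
  cong₂ _+_ (area-weightless x y wx wy) (cong₂ ∣_-_∣ wx wy)

area-complement : ∀ x y → length x ≡ length y → area (complement x) (complement y) ≡ area x y
area-complement []      []      _  = refl
area-complement (_ ∷ x) (_ ∷ y) eq = cong₂ _+_ (area-complement x y (suc-injective eq))
  (∣-∣-shift _ _ (weight x) (weight y)
    (trans (weight-complement x) (trans (suc-injective eq) (sym (weight-complement y)))))

area-raise : ∀ c x y → length x ≡ c + suc (length y) → weight x ≤ weight y →
  area x (replicate c false ++ true ∷ y) ≡ area x (replicate c false ++ false ∷ y) + c
area-raise zero    []      y () _
area-raise (suc c) []      y () _
area-raise zero    (_ ∷ x) y _  _ = sym (+-identityʳ _)
-- Every suffix weight of x is at most weight y, so each of the c gaps that see the raised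
-- letter grows by exactly one.
area-raise (suc c) (b ∷ x) y ∣x∣ wx≤wy = begin
  area x (replicate c false ++ true ∷ y) + ∣ weight x - weight (replicate c false ++ true ∷ y) ∣
    ≡⟨ cong₂ _+_ (area-raise c x y (suc-injective ∣x∣) wx′≤wy)
                 (cong (∣ weight x -_∣) (weight-falses++ c (true ∷ y))) ⟩
  (A + c) + ∣ weight x - suc (weight y) ∣
    ≡⟨ cong ((A + c) +_) (∣m-1+n∣≡1+∣m-n∣ wx′≤wy) ⟩
  (A + c) + suc ∣ weight x - weight y ∣
    ≡⟨ shuffle A c ∣ weight x - weight y ∣ ⟩
  (A + ∣ weight x - weight y ∣) + suc c
    ≡⟨ cong (λ m → (A + ∣ weight x - m ∣) + suc c) (sym (weight-falses++ c (false ∷ y))) ⟩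
  (A + ∣ weight x - weight (replicate c false ++ false ∷ y) ∣) + suc c ∎
  where
  open ≡-Reasoning
  A : ℕ
  A = area x (replicate c false ++ false ∷ y)
  wx′≤wy : weight x ≤ weight y
  wx′≤wy = ≤-trans (weight-∷-≥ b x) wx≤wy
  shuffle : ∀ a c d → (a + c) + suc d ≡ (a + d) + suc c
  shuffle = solve-∀

area-true-true : ∀ a b x y → a + length x ≡ b + length y → weight x ≡ weight y →
  area (replicate a false ++ true ∷ x) (replicate b false ++ true ∷ y)
    ≡ area (replicate a false ++ false ∷ x) (replicate b false ++ false ∷ y) + ∣ a - b ∣
area-true-true zero    zero    x y _  _  = sym (+-identityʳ _)
area-true-true zero    (suc b) x y eq wt =
  -- area ignores the first letters, so the leading true of the left word may be read as false
  area-raise (suc b) (false ∷ x) y (trans (cong suc eq) (sym (+-suc (suc b) (length y)))) (≤-reflexive wt)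
area-true-true (suc a) zero    x y eq wt = begin
  area (replicate (suc a) false ++ true ∷ x) (true ∷ y)
    ≡⟨ area-comm (replicate (suc a) false ++ true ∷ x) (true ∷ y) ⟩
  area (true ∷ y) (replicate (suc a) false ++ true ∷ x)
    ≡⟨ area-true-true zero (suc a) y x (sym eq) (sym wt) ⟩
  area (false ∷ y) (replicate (suc a) false ++ false ∷ x) + suc a
    ≡⟨ cong (_+ suc a) (area-comm (false ∷ y) (replicate (suc a) false ++ false ∷ x)) ⟩
  area (replicate (suc a) false ++ false ∷ x) (false ∷ y) + suc a ∎
  where open ≡-Reasoning
area-true-true (suc a) (suc b) x y eq wt = begin
  area X₁ Y₁ + ∣ weight X₁ - weight Y₁ ∣
    ≡⟨ cong₂ _+_ (area-true-true a b x y (suc-injective eq) wt)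
                 (cong₂ ∣_-_∣ (weight-falses++ a (true ∷ x)) (weight-falses++ b (true ∷ y))) ⟩
  (area X₀ Y₀ + ∣ a - b ∣) + ∣ weight x - weight y ∣
    ≡⟨ shuffle (area X₀ Y₀) ∣ a - b ∣ ∣ weight x - weight y ∣ ⟩
  (area X₀ Y₀ + ∣ weight x - weight y ∣) + ∣ a - b ∣
    ≡⟨ cong (λ e → (area X₀ Y₀ + e) + ∣ a - b ∣)
            (sym (cong₂ ∣_-_∣ (weight-falses++ a (false ∷ x)) (weight-falses++ b (false ∷ y)))) ⟩
  (area X₀ Y₀ + ∣ weight X₀ - weight Y₀ ∣) + ∣ a - b ∣ ∎
  where
  open ≡-Reasoning
  X₁ Y₁ X₀ Y₀ : Word
  X₁ = replicate a false ++ true ∷ x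
  Y₁ = replicate b false ++ true ∷ y
  X₀ = replicate a false ++ false ∷ x
  Y₀ = replicate b false ++ false ∷ y
  shuffle : ∀ a d e → (a + d) + e ≡ (a + e) + d
  shuffle = solve-∀

pad : ℕ → Word → Word
pad L w = replicate (L ∸ length w) false ++ w

weight-pad : ∀ L w → weight (pad L w) ≡ weight w
weight-pad L w = weight-falses++ (L ∸ length w) w

pad-false : ∀ {L} w → length w < L → pad L (false ∷ w) ≡ pad L w
pad-false {L} w ∣w∣<L = trans (replicate-++-∷ (L ∸ suc (length w)) false w)
  (cong (λ a → replicate a false ++ w) (sym (+-∸-assoc 1 ∣w∣<L)))

pad-exact : ∀ {n} w → length w ≡ n → pad n w ≡ w
pad-exact {n} w refl = cong (λ a → replicate a false ++ w) (n∸n≡0 (length w))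

area-pad-true : ∀ {L} w v → length w < L → length v < L → weight w ≡ weight v →
  area (pad L (true ∷ w)) (pad L (true ∷ v)) ≡ area (pad L w) (pad L v) + ∣ length w - length v ∣
area-pad-true {L} w v ∣w∣<L ∣v∣<L wt = begin
  area (pad L (true ∷ w)) (pad L (true ∷ v))
    ≡⟨ area-true-true a b w v lengths wt ⟩
  area (pad L (false ∷ w)) (pad L (false ∷ v)) + ∣ a - b ∣
    ≡⟨ cong₂ _+_ (cong₂ area (pad-false w ∣w∣<L) (pad-false v ∣v∣<L))
                 (∣-∣-shift a b (length w) (length v) lengths) ⟩
  area (pad L w) (pad L v) + ∣ length w - length v ∣ ∎
  where
  open ≡-Reasoning
  a b : ℕ
  a = L ∸ suc (length w)
  b = L ∸ suc (length v)
  lengths : a + length w ≡ b + length v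
  lengths = suc-injective (begin
    suc (a + length w) ≡⟨ sym (+-suc a (length w)) ⟩
    a + suc (length w) ≡⟨ m∸n+n≡m ∣w∣<L ⟩
    L                  ≡⟨ sym (m∸n+n≡m ∣v∣<L) ⟩
    b + suc (length v) ≡⟨ +-suc b (length v) ⟩
    suc (b + length v) ∎)

areaSum : ℕ → ℕ → ℕ → ℕ → ℕ
areaSum L p q k = doubleSum p q k λ w v → area (pad L w) (pad L v)

areaSum-weight-zero : ∀ L p q → areaSum L p q 0 ≡ 0
areaSum-weight-zero L p q = sumWords-zero p 0 λ w _ wt → sumWords-zero q 0 λ v _ wt′ →
  area-weightless (pad L w) (pad L v) (trans (weight-pad L w) wt) (trans (weight-pad L v) wt′)

areaSum-length-zeroˡ : ∀ L q k → areaSum L 0 q k ≡ 0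
areaSum-length-zeroˡ L q zero    = areaSum-weight-zero L 0 q
areaSum-length-zeroˡ L q (suc k) = refl

areaSum-length-zeroʳ : ∀ L p k → areaSum L p 0 k ≡ 0
areaSum-length-zeroʳ L p zero    = areaSum-weight-zero L p 0
areaSum-length-zeroʳ L p (suc k) = sumWords-zero p (suc k) λ _ _ _ → refl

areaSum-length-one : ∀ L k → areaSum L 1 1 k ≡ 0
areaSum-length-one L zero          = areaSum-weight-zero L 1 1
areaSum-length-one L (suc zero)    = area-self (pad L (true ∷ []))
areaSum-length-one L (suc (suc k)) = refl

areaSum-recurrence : ∀ L p q j → p < L → q < L →
  areaSum L (suc p) (suc q) (suc j) + areaSum L p q (suc j)
    ≡ (areaSum L p (suc q) (suc j) + areaSum L (suc p) q (suc j))
      + (areaSum L p q j + ∣ p - q ∣ * ((p C j) * (q C j)))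
areaSum-recurrence L p q j p<L q<L = begin
  areaSum L (suc p) (suc q) (suc j) + areaSum L p q (suc j)
    ≡⟨ doubleSum-split p q j A dropˡ dropʳ ⟩
  S + doubleSum p q j (λ w v → A (true ∷ w) (true ∷ v))
    ≡⟨ cong (S +_) (doubleSum-cong p q j raise) ⟩
  S + doubleSum p q j (λ w v → A w v + ∣ p - q ∣)
    ≡⟨ cong (S +_) (doubleSum-+-const p q j ∣ p - q ∣ A) ⟩
  S + (areaSum L p q j + ∣ p - q ∣ * ((p C j) * (q C j))) ∎
  where
  open ≡-Reasoning
  A : Word → Word → ℕ
  A w v = area (pad L w) (pad L v)
  S : ℕ
  S = areaSum L p (suc q) (suc j) + areaSum L (suc p) q (suc j)
  fits : ∀ {n} w → length w ≡ n → n < L → length w < L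
  fits w refl n<L = n<L
  dropˡ : ∀ w v → length w ≡ p → A (false ∷ w) v ≡ A w v
  dropˡ w v ∣w∣ = cong (λ x → area x (pad L v)) (pad-false w (fits w ∣w∣ p<L))
  dropʳ : ∀ w v → length v ≡ q → A w (false ∷ v) ≡ A w v
  dropʳ w v ∣v∣ = cong (area (pad L w)) (pad-false v (fits v ∣v∣ q<L))
  raise : ∀ w v → length w ≡ p → length v ≡ q → weight w ≡ j → weight v ≡ j →
          A (true ∷ w) (true ∷ v) ≡ A w v + ∣ p - q ∣
  raise w v ∣w∣ ∣v∣ wt wt′ = begin
    A (true ∷ w) (true ∷ v)          ≡⟨ area-pad-true w v (fits w ∣w∣ p<L) (fits v ∣v∣ q<L) (trans wt (sym wt′)) ⟩
    A w v + ∣ length w - length v ∣  ≡⟨ cong (λ d → A w v + d) (cong₂ ∣_-_∣ ∣w∣ ∣v∣) ⟩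
    A w v + ∣ p - q ∣                ∎

recurrenceRHS : ℕ → ℕ → Poly → Poly → Poly → Poly
recurrenceRHS p q n₁ n₂ n₃ k =
  ((n₁ k ℤ.+ n₂ k) ℤ.- (n₃ k ℤ.- tMul n₃ k)) ℤ.+ (ℤ.+ ∣ p - q ∣) ℤ.* tMul (W (suc p) (suc q)) k

tMul-cong : ∀ {f g : Poly} → (∀ k → f k ≡ g k) → ∀ k → tMul f k ≡ tMul g k
tMul-cong f≗g zero    = refl
tMul-cong f≗g (suc k) = f≗g k

recurrenceRHS-cong : ∀ p q {n₁ n₂ n₃ m₁ m₂ m₃ : Poly} →
  (∀ k → n₁ k ≡ m₁ k) → (∀ k → n₂ k ≡ m₂ k) → (∀ k → n₃ k ≡ m₃ k) →
  ∀ k → recurrenceRHS p q n₁ n₂ n₃ k ≡ recurrenceRHS p q m₁ m₂ m₃ k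
recurrenceRHS-cong p q e₁ e₂ e₃ k =
  cong (ℤ._+ (ℤ.+ ∣ p - q ∣) ℤ.* tMul (W (suc p) (suc q)) k)
    (cong₂ ℤ._-_ (cong₂ ℤ._+_ (e₁ k) (e₂ k)) (cong₂ ℤ._-_ (e₃ k) (tMul-cong e₃ k)))

pos-recurrence : ∀ {a b₁ b₂ c c′ d e} → a + c ≡ (b₁ + b₂) + (c′ + d * e) →
  ℤ.+ a ≡ ((ℤ.+ b₁ ℤ.+ ℤ.+ b₂) ℤ.- (ℤ.+ c ℤ.- ℤ.+ c′)) ℤ.+ ℤ.+ d ℤ.* ℤ.+ e
pos-recurrence {a} {b₁} {b₂} {c} {c′} {d} {e} eq = begin
  ℤ.+ a
    ≡⟨ add-sub (ℤ.+ a) (ℤ.+ c) ⟩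
  (ℤ.+ a ℤ.+ ℤ.+ c) ℤ.- ℤ.+ c
    ≡⟨ cong (ℤ._- ℤ.+ c) lifted ⟩
  ((ℤ.+ b₁ ℤ.+ ℤ.+ b₂) ℤ.+ (ℤ.+ c′ ℤ.+ ℤ.+ d ℤ.* ℤ.+ e)) ℤ.- ℤ.+ c
    ≡⟨ regroup (ℤ.+ b₁) (ℤ.+ b₂) (ℤ.+ c) (ℤ.+ c′) (ℤ.+ d ℤ.* ℤ.+ e) ⟩
  ((ℤ.+ b₁ ℤ.+ ℤ.+ b₂) ℤ.- (ℤ.+ c ℤ.- ℤ.+ c′)) ℤ.+ ℤ.+ d ℤ.* ℤ.+ e ∎
  where
  open ≡-Reasoning
  lifted : ℤ.+ a ℤ.+ ℤ.+ c ≡ (ℤ.+ b₁ ℤ.+ ℤ.+ b₂) ℤ.+ (ℤ.+ c′ ℤ.+ ℤ.+ d ℤ.* ℤ.+ e)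
  lifted = begin
    ℤ.+ a ℤ.+ ℤ.+ c                                  ≡⟨ sym (ℤ.pos-+ a c) ⟩
    ℤ.+ (a + c)                                      ≡⟨ cong ℤ.+_ eq ⟩
    ℤ.+ ((b₁ + b₂) + (c′ + d * e))                   ≡⟨ ℤ.pos-+ (b₁ + b₂) (c′ + d * e) ⟩
    ℤ.+ (b₁ + b₂) ℤ.+ ℤ.+ (c′ + d * e)               ≡⟨ cong₂ ℤ._+_ (ℤ.pos-+ b₁ b₂) (ℤ.pos-+ c′ (d * e)) ⟩
    (ℤ.+ b₁ ℤ.+ ℤ.+ b₂) ℤ.+ (ℤ.+ c′ ℤ.+ ℤ.+ (d * e)) ≡⟨ cong (λ x → (ℤ.+ b₁ ℤ.+ ℤ.+ b₂) ℤ.+ (ℤ.+ c′ ℤ.+ x)) (ℤ.pos-* d e) ⟩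
    (ℤ.+ b₁ ℤ.+ ℤ.+ b₂) ℤ.+ (ℤ.+ c′ ℤ.+ ℤ.+ d ℤ.* ℤ.+ e) ∎
  add-sub : ∀ (x y : ℤ) → x ≡ (x ℤ.+ y) ℤ.- y
  add-sub = ℤ-Solver.solve-∀
  regroup : ∀ (x₁ x₂ y y′ z : ℤ) → ((x₁ ℤ.+ x₂) ℤ.+ (y′ ℤ.+ z)) ℤ.- y ≡ ((x₁ ℤ.+ x₂) ℤ.- (y ℤ.- y′)) ℤ.+ z
  regroup = ℤ-Solver.solve-∀

areaSum-satisfies-recurrence : ∀ L p q → p < L → q < L → ∀ k →
  ℤ.+ areaSum L (suc p) (suc q) k
    ≡ recurrenceRHS p q (λ i → ℤ.+ areaSum L p (suc q) i) (λ i → ℤ.+ areaSum L (suc p) q i)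
                        (λ i → ℤ.+ areaSum L p q i) k
areaSum-satisfies-recurrence L p q p<L q<L zero =
  pos-recurrence {b₁ = areaSum L p (suc q) 0} {b₂ = areaSum L (suc p) q 0} {c′ = 0} {d = ∣ p - q ∣} {e = 0}
    (trans (cong₂ _+_ (areaSum-weight-zero L (suc p) (suc q)) (areaSum-weight-zero L p q))
           (sym (cong₂ _+_ (cong₂ _+_ (areaSum-weight-zero L p (suc q)) (areaSum-weight-zero L (suc p) q))
                           (*-zeroʳ ∣ p - q ∣))))
areaSum-satisfies-recurrence L p q p<L q<L (suc j) =
  pos-recurrence {b₁ = areaSum L p (suc q) (suc j)} {b₂ = areaSum L (suc p) q (suc j)} {c′ = areaSum L p q j}
                 {d = ∣ p - q ∣} {e = (p C j) * (q C j)}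
    (areaSum-recurrence L p q j p<L q<L)

N≡areaSum : ∀ {L} p q → p ≤ L → q ≤ L → ∀ k → N p q k ≡ ℤ.+ areaSum L p q k
N≡areaSum {L} zero          q             _ _ k = cong ℤ.+_ (sym (areaSum-length-zeroˡ L q k))
N≡areaSum {L} (suc p)       zero          _ _ k = cong ℤ.+_ (sym (areaSum-length-zeroʳ L (suc p) k))
N≡areaSum {L} (suc zero)    (suc zero)    _ _ k = cong ℤ.+_ (sym (areaSum-length-one L k))
N≡areaSum {L} (suc zero)    (suc (suc q)) 1≤L 2+q≤L k = trans
  (recurrenceRHS-cong 0 (suc q) (N≡areaSum 0 (suc (suc q)) z≤n 2+q≤L)
                                (N≡areaSum 1 (suc q) 1≤L (<⇒≤ 2+q≤L))
                                (N≡areaSum 0 (suc q) z≤n (<⇒≤ 2+q≤L)) k)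
  (sym (areaSum-satisfies-recurrence L 0 (suc q) 1≤L 2+q≤L k))
N≡areaSum {L} (suc (suc p)) (suc q)       2+p≤L 1+q≤L k = trans
  (recurrenceRHS-cong (suc p) q (N≡areaSum (suc p) (suc q) (<⇒≤ 2+p≤L) 1+q≤L)
                                (N≡areaSum (suc (suc p)) q 2+p≤L (<⇒≤ 1+q≤L))
                                (N≡areaSum (suc p) q (<⇒≤ 2+p≤L) (<⇒≤ 1+q≤L)) k)
  (sym (areaSum-satisfies-recurrence L (suc p) q 2+p≤L 1+q≤L k))

N-diagonal : ∀ n k → N n n k ≡ ℤ.+ doubleSum n n k area
N-diagonal n k = trans (N≡areaSum n n ≤-refl ≤-refl k)
  (cong ℤ.+_ (doubleSum-cong n n k λ w v ∣w∣ ∣v∣ _ _ → cong₂ area (pad-exact w ∣w∣) (pad-exact v ∣v∣)))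

N-diagonal-reflect : ∀ n k → k ≤ n → N n n k ≡ N n n (n ∸ k)
N-diagonal-reflect n k k≤n = begin
  N n n k
    ≡⟨ N-diagonal n k ⟩
  ℤ.+ doubleSum n n k area
    ≡⟨ cong ℤ.+_ (doubleSum-complement n k area k≤n) ⟩
  ℤ.+ doubleSum n n (n ∸ k) (λ w v → area (complement w) (complement v))
    ≡⟨ cong ℤ.+_ (doubleSum-cong n n (n ∸ k) λ w v ∣w∣ ∣v∣ _ _ →
                    area-complement w v (trans ∣w∣ (sym ∣v∣))) ⟩
  ℤ.+ doubleSum n n (n ∸ k) area
    ≡⟨ sym (N-diagonal n (n ∸ k)) ⟩
  N n n (n ∸ k) ∎
  where open ≡-Reasoning

N-diagonal-vanishes : ∀ n k → n < k → N n n k ≡ ℤ.+ 0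
N-diagonal-vanishes n k n<k = trans (N-diagonal n k) (cong ℤ.+_ (sumWords-overweight _ n<k))

≤-of-vanishing-above : ∀ {f : Poly} {m k} → (∀ i → m < i → f i ≡ ℤ.+ 0) → f k ≢ ℤ.+ 0 → k ≤ m
≤-of-vanishing-above {m = m} {k} vanish fk≢0 with k ≤? m
... | yes k≤m = k≤m
... | no  k≰m = ⊥-elim (fk≢0 (vanish k (≰⇒> k≰m)))

≥-of-vanishing-below : ∀ {f : Poly} {m k} → (∀ i → i < m → f i ≡ ℤ.+ 0) → f k ≢ ℤ.+ 0 → m ≤ k
≥-of-vanishing-below {m = m} {k} vanish fk≢0 with m ≤? k
... | yes m≤k = m≤k
... | no  m≰k = ⊥-elim (fk≢0 (vanish k (≰⇒> m≰k)))

palindromic-of-reflection : ∀ (f : Poly) n → (∀ k → k ≤ n → f k ≡ f (n ∸ k)) →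
  (∀ k → n < k → f k ≡ ℤ.+ 0) → Palindromic f
palindromic-of-reflection f n reflect vanish a b (fa≢0 , below-a) (fb≢0 , above-b) k a≤k k≤b =
  subst (λ m → f k ≡ f (m ∸ k)) (sym a+b≡n) (reflect k (≤-trans k≤b b≤n))
  where
  b≤n : b ≤ n
  b≤n = ≤-of-vanishing-above vanish fb≢0
  a≤n : a ≤ n
  a≤n = ≤-trans a≤k (≤-trans k≤b b≤n)
  n∸a≤b : n ∸ a ≤ b
  n∸a≤b = ≤-of-vanishing-above above-b (λ eq → fa≢0 (trans (reflect a a≤n) eq))
  a≤n∸b : a ≤ n ∸ b
  a≤n∸b = ≥-of-vanishing-below below-a (λ eq → fb≢0 (trans (reflect b b≤n) eq))
  a+b≡n : a + b ≡ n
  a+b≡n = ≤-antisym (m≤o∸n⇒m+n≤o a b≤n a≤n∸b) (begin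
    n           ≡⟨ sym (m∸n+n≡m a≤n) ⟩
    n ∸ a + a   ≤⟨ +-monoˡ-≤ a n∸a≤b ⟩
    b + a       ≡⟨ +-comm b a ⟩
    a + b       ∎)
    where open ≤-Reasoning

corollary3p2 : (n : ℕ) → 1 ≤ n → Palindromic (N n n)
-- The argument works for every n (for n = 0 the claim is vacuous).
corollary3p2 n _ = palindromic-of-reflection (N n n) n (N-diagonal-reflect n) (N-diagonal-vanishes n)
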